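{- Consider an instance of the Limited Query Graph Connectivity Test problem, a set $P$ of $s$–$t$ paths, and a set $C$ of $s$–$t$ cuts (as in the context). For every tree structure $S$, we have $c(S,P,C)\le c(P,C)$.
   Context: An instance consists of a graph $G=(V,E)$ (undirected or directed), source $s$, destination $t$, probability $p\in(0,1)$, and query limit $B$. Each edge is independently On with probability $p$ and Off otherwise; states are hidden until queried and a query reveals the state permanently. A path (an $s$–$t$ path, as an edge set) is disproved once some edge of it is revealed Off; a cut (an $s$–$t$ cut, as an edge set) is disproved once some edge of it is revealed On. $c(P,C)$ is the minimum, over adaptive query policies, of the expected number of queries made until all paths in $P$ are disproved, or all cuts in $C$ are disproved, or $B$ queries have been made. A tree structure $S$ is a finite rooted binary tree in which each node has either no children or both a left and a right child, with at most $B$ levels (the shape of a policy tree). A filling of $S$ labels each node either with an edge of $G$ (a query node) or with Done. Reaching a node from the root, each left turn means the parent's queried edge was revealed On and each right turn means it was revealed Off; the probability $\mathrm{Prob}(i)$ of reaching node $i$ is $p^{a}(1-p)^{b}$ where $a$, $b$ are the numbers of left and right turns on the route from the root to $i$. A filling is a correct policy tree with respect to $P$ and $C$ if: along every root-to-leaf route each edge is queried at most once; every child of a Done node is Done; and at every Done node, the query results along the route from the root disprove all paths in $P$ or disprove all cuts in $C$ (leaves that are query nodes, i.e. inconclusive endings, are allowed). The cost of a filling is $\sum_{i \text{ query node}} \mathrm{Prob}(i)$. $c(S,P,C)$ is the minimum cost of a correct policy tree with structure $S$ with respect to $P$ and $C$.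
   Formalization: The probability $p$ that an edge is On ranges only over the rationals in $(0,1)$. -}

module Defs where

open import Data.Bool using (Bool; true; false; if_then_else_; _∧_; _∨_; not)
open import Data.Nat using (ℕ; zero; suc; _⊔_)
open import Data.Fin using (Fin; _≟_)
open import Data.Maybe using (Maybe; just; nothing)
open import Data.List using (List; []; _∷_; allFin)
open import Data.Bool.ListAction using (any; all)
open import Data.List.Membership.Propositional using (_∈_)
open import Data.List.Relation.Unary.Unique.Propositional using (Unique)
open import Data.Product using (Σ; _×_; ∃; _,_)
open import Data.Sum using (_⊎_)
open import Data.Unit using (⊤)
open import Data.Rational using (ℚ; 0ℚ; 1ℚ; _+_; _*_; _-_)
open import Relation.Nullary using (does)
open import Relation.Binary.PropositionalEquality using (_≡_)

record Graph : Set where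
  field
    nV       : ℕ
    nE       : ℕ
    directed : Bool
    src      : Fin nE → Fin nV
    tgt      : Fin nE → Fin nV
open Graph public

EdgeSet : Graph → Set
EdgeSet G = Fin (nE G) → Bool

Step : (G : Graph) → Fin (nV G) → Fin (nE G) → Fin (nV G) → Set
Step G u e v = (src G e ≡ u × tgt G e ≡ v)
             ⊎ (directed G ≡ false × src G e ≡ v × tgt G e ≡ u)

data Walk (G : Graph) : Fin (nV G) → Fin (nV G) → List (Fin (nV G)) → List (Fin (nE G)) → Set where
  nil  : ∀ {v} → Walk G v v (v ∷ []) []
  cons : ∀ {u e v w vs es} → Step G u e v → Walk G v w vs es → Walk G u w (u ∷ vs) (e ∷ es)

IsPath : (G : Graph) → Fin (nV G) → Fin (nV G) → EdgeSet G → Set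
IsPath G s t E = Σ (List (Fin (nV G))) λ vs → Σ (List (Fin (nE G))) λ es →
  Walk G s t vs es × Unique vs × (∀ e → (E e ≡ true → e ∈ es) × (e ∈ es → E e ≡ true))

IsCut : (G : Graph) → Fin (nV G) → Fin (nV G) → EdgeSet G → Set
IsCut G s t E = ∀ vs es → Walk G s t vs es → Σ (Fin (nE G)) λ e → e ∈ es × E e ≡ true

-- Knowledge: revealed states (just true = On, just false = Off, nothing = unqueried)

Know : ℕ → Set
Know m = Fin m → Maybe Bool

unknown : ∀ {m} → Know m
unknown _ = nothing

reveal : ∀ {m} → Know m → Fin m → Bool → Know m
reveal k e b e' = if does (e' ≟ e) then just b else k e'

isOff isOn : Maybe Bool → Bool
isOff (just false) = true
isOff _            = false
isOn (just true) = true
isOn _           = false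

pathDisproved : ∀ {m} → Know m → (Fin m → Bool) → Bool
pathDisproved {m} k E = any (λ e → E e ∧ isOff (k e)) (allFin m)

cutDisproved : ∀ {m} → Know m → (Fin m → Bool) → Bool
cutDisproved {m} k E = any (λ e → E e ∧ isOn (k e)) (allFin m)

stopped : ∀ {m} → List (Fin m → Bool) → List (Fin m → Bool) → Know m → Bool
stopped P C k = all (pathDisproved k) P ∨ all (cutDisproved k) C

-- Adaptive query policies (decision trees; left = On, right = Off)

data Policy (m : ℕ) : Set where
  halt : Policy m
  ask  : Fin m → Policy m → Policy m → Policy m

-- A policy must keep querying until the stopping condition holds or the
-- budget is exhausted (re-querying a known edge is allowed, but wasted).
ValidPolicy : ∀ {m} → List (Fin m → Bool) → List (Fin m → Bool) → ℕ → Know m → Policy m → Set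
ValidPolicy P C b k π with stopped P C k
... | true = ⊤
ValidPolicy P C zero k π | false = ⊤
ValidPolicy P C (suc b) k halt | false = Data.Empty.⊥
  where import Data.Empty
ValidPolicy P C (suc b) k (ask e l r) | false with k e
... | just true  = ValidPolicy P C b k l
... | just false = ValidPolicy P C b k r
... | nothing    = ValidPolicy P C b (reveal k e true) l × ValidPolicy P C b (reveal k e false) r

policyCost : ∀ {m} → ℚ → List (Fin m → Bool) → List (Fin m → Bool) → ℕ → Know m → Policy m → ℚ
policyCost p P C b k π with stopped P C k
... | true = 0ℚ
policyCost p P C zero k π | false = 0ℚ
policyCost p P C (suc b) k halt | false = 0ℚ
policyCost p P C (suc b) k (ask e l r) | false with k e
... | just true  = 1ℚ + policyCost p P C b k l
... | just false = 1ℚ + policyCost p P C b k r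
... | nothing    = 1ℚ + (p * policyCost p P C b (reveal k e true) l
                         + (1ℚ - p) * policyCost p P C b (reveal k e false) r)

data Shape : Set where
  leaf : Shape
  node : Shape → Shape → Shape

levels : Shape → ℕ
levels leaf       = 1
levels (node l r) = suc (levels l ⊔ levels r)

-- a label: just e = query edge e, nothing = Done
data Filling (m : ℕ) : Shape → Set where
  fleaf : Maybe (Fin m) → Filling m leaf
  fnode : ∀ {l r} → Maybe (Fin m) → Filling m l → Filling m r → Filling m (node l r)

label : ∀ {m S} → Filling m S → Maybe (Fin m)
label (fleaf a)     = a
label (fnode a _ _) = a

isDone : ∀ {m} → Maybe (Fin m) → Set
isDone a = a ≡ nothing

Correct : ∀ {m S} → List (Fin m → Bool) → List (Fin m → Bool) → Know m → Filling m S → Set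
Correct P C k (fleaf nothing)  = stopped P C k ≡ true
Correct P C k (fleaf (just e)) = k e ≡ nothing
Correct P C k (fnode nothing l r) =
  stopped P C k ≡ true × isDone (label l) × isDone (label r)
  × Correct P C k l × Correct P C k r
Correct P C k (fnode (just e) l r) =
  k e ≡ nothing × Correct P C (reveal k e true) l × Correct P C (reveal k e false) r

-- cost = sum over query nodes of Prob(node)
fillCost : ∀ {m S} → ℚ → Filling m S → ℚ
fillCost p (fleaf nothing)  = 0ℚ
fillCost p (fleaf (just e)) = 1ℚ
fillCost p (fnode a l r) = q a + (p * fillCost p l + (1ℚ - p) * fillCost p r)
  where
    q : Maybe _ → ℚ
    q nothing  = 0ℚ
    q (just _) = 1ℚ

{-# OPTIONS --safe #-}
-- The filling is built by dynamic programming: at a node whose knowledge has not yet stopped,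
-- query the unrevealed edge that minimises the expected cost of the (recursively built)
-- subtrees. Such an edge always exists: once every edge is revealed, a path that is not
-- disproved consists of On edges and meets every cut, so all cuts are disproved. Against any
-- valid policy we argue by induction on the budget: if the policy queries an unrevealed edge e,
-- the filling could have queried e as well and its minimising choice does at least as well;
-- a query of an already revealed edge spends budget for nothing and is absorbed by a slack.
module Submission where

open import Defs
open import Data.Nat using (ℕ) renaming (_≤_ to _≤ℕ_)
open import Data.Fin using (Fin)
open import Data.List using (List)
open import Data.List.Relation.Unary.All using (All)
open import Data.Product using (Σ; _×_)
open import Data.Rational using (ℚ; 0ℚ; 1ℚ; _<_; _≤_)

open import Data.Bool using (Bool; true; false; T; _∧_; if_then_else_)
import Data.Bool.Properties as Bool
open import Data.Bool.ListAction using (all)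
open import Data.Empty using (⊥-elim)
open import Data.List using ([]; _∷_; filter; allFin)
open import Data.List.Membership.Propositional using (_∈_; find; lose)
open import Data.List.Membership.Propositional.Properties using (∈-allFin; ∈-filter⁺; ∈-filter⁻; ∉[])
open import Data.List.Relation.Unary.All using (tabulate) renaming (map to mapᴬ; lookup to lookupᴬ)
open import Data.List.Relation.Unary.All.Properties using (all⁻; ¬All⇒Any¬)
open import Data.List.Relation.Unary.Any using (here; there)
open import Data.List.Relation.Unary.Any.Properties using (any⁺)
import Data.Maybe.Properties as Maybe
open import Data.Maybe using (just; nothing)
open import Data.Nat using (zero; suc; _⊔_; s≤s) renaming (_+_ to _+ℕ_)
import Data.Nat.Properties as ℕ
open import Data.Product using (∃; _,_; proj₁; proj₂)
open import Data.Rational using (_+_; _*_; _-_; -_; NonNegative; nonNegative)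
import Data.Rational.Properties as ℚ
open import Data.Rational.Solver using (module +-*-Solver)
open import Data.Sum using (_⊎_; inj₁; inj₂)
open import Data.Unit using (tt)
open import Function using (_∘_; Equivalence)
open import Relation.Binary.Bundles using (DecTotalOrder)
open import Relation.Binary.PropositionalEquality
  using (_≡_; _≢_; refl; sym; trans; cong; cong₂; subst; subst₂; module ≡-Reasoning)
open import Relation.Nullary using (¬_; contradiction; yes; no)
open import Relation.Nullary.Decidable using (T?)
open import Relation.Unary using (Decidable)

open import Data.List.Extrema (DecTotalOrder.totalOrder ℚ.≤-decTotalOrder)
  using (argmin; argmin-all; f[argmin]≤f[⊤]; f[argmin]≤f[xs])

Revealed : ∀ {m} → Know m → Set
Revealed k = ∀ e → k e ≢ nothing

module _ {m} (k : Know m) where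

  off-edge⇒pathDisproved : ∀ E {e} → E e ≡ true → k e ≡ just false → T (pathDisproved k E)
  off-edge⇒pathDisproved E {e} Ee ke =
    any⁺ _ (lose (∈-allFin e) (subst T (sym (cong₂ _∧_ Ee (cong isOff ke))) tt))

  on-edge⇒cutDisproved : ∀ D {e} → D e ≡ true → k e ≡ just true → T (cutDisproved k D)
  on-edge⇒cutDisproved D {e} De ke =
    any⁺ _ (lose (∈-allFin e) (subst T (sym (cong₂ _∧_ De (cong isOn ke))) tt))

  undisproved-path-On : Revealed k → ∀ E → ¬ T (pathDisproved k E) → ∀ {e} → E e ≡ true → k e ≡ just true
  undisproved-path-On revealed E undisproved {e} Ee with k e in ke
  ... | just true  = refl
  ... | just false = contradiction (off-edge⇒pathDisproved E Ee ke) undisproved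
  ... | nothing    = ⊥-elim (revealed e ke)

path-meets-cut : ∀ {G s t E D} → IsPath G s t E → IsCut G s t D → ∃ λ e → E e ≡ true × D e ≡ true
path-meets-cut (vs , es , walk , _ , E≡es) cut with cut vs es walk
... | e , e∈es , De = e , proj₂ (E≡es e) e∈es , De

revealed-undisproved-path⇒cutDisproved : ∀ {G s t E D} (k : Know (nE G)) → Revealed k
  → IsPath G s t E → ¬ T (pathDisproved k E) → IsCut G s t D → T (cutDisproved k D)
revealed-undisproved-path⇒cutDisproved {E = E} {D} k revealed path undisproved cut
  with path-meets-cut path cut
... | e , Ee , De = on-edge⇒cutDisproved k D De (undisproved-path-On k revealed E undisproved Ee)

revealed⇒stopped : ∀ {G s t} {P C : List (EdgeSet G)} → All (IsPath G s t) P → All (IsCut G s t) C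
  → ∀ k → Revealed k → stopped P C k ≡ true
revealed⇒stopped {P = P} {C} paths cuts k revealed =
  Equivalence.to Bool.T-≡ (Equivalence.from Bool.T-∨ paths-or-cuts-disproved)
  where
  paths-or-cuts-disproved : T (all (pathDisproved k) P) ⊎ T (all (cutDisproved k) C)
  paths-or-cuts-disproved with T? (all (pathDisproved k) P)
  ... | yes all-disproved = inj₁ all-disproved
  ... | no ¬all-disproved
    with find (¬All⇒Any¬ (T? ∘ pathDisproved k) P (¬all-disproved ∘ all⁻ (pathDisproved k)))
  ... | E , E∈P , undisproved = inj₂ (all⁻ (cutDisproved k)
    (mapᴬ (revealed-undisproved-path⇒cutDisproved k revealed (lookupᴬ paths E∈P) undisproved) cuts))

mix : ℚ → ℚ → ℚ → ℚ
mix p a b = p * a + (1ℚ - p) * b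

open +-*-Solver using (solve; _:=_; _:+_; _:*_; _:-_; con)

mix-const : ∀ p a → mix p a a ≡ a
mix-const = solve 2 (λ p a → p :* a :+ (con 1ℚ :- p) :* a := a) refl

mix-+ : ∀ p a b c → mix p (a + c) (b + c) ≡ mix p a b + c
mix-+ = solve 4 (λ p a b c → p :* (a :+ c) :+ (con 1ℚ :- p) :* (b :+ c)
                           := (p :* a :+ (con 1ℚ :- p) :* b) :+ c) refl

0≤1 : 0ℚ ≤ 1ℚ
0≤1 = ℚ.nonNegative⁻¹ 1ℚ

p≤p+q : ∀ p {q} → 0ℚ ≤ q → p ≤ p + q
p≤p+q p {q} 0≤q = subst (_≤ p + q) (ℚ.+-identityʳ p) (ℚ.+-monoʳ-≤ p 0≤q)

fromℕ : ℕ → ℚ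
fromℕ zero    = 0ℚ
fromℕ (suc n) = 1ℚ + fromℕ n

0≤fromℕ : ∀ n → 0ℚ ≤ fromℕ n
0≤fromℕ zero    = ℚ.≤-refl
0≤fromℕ (suc n) = ℚ.+-mono-≤ 0≤1 (0≤fromℕ n)

allDone : ∀ {m} S → Filling m S
allDone leaf       = fleaf nothing
allDone (node l r) = fnode nothing (allDone l) (allDone r)

label-allDone : ∀ {m} S → label (allDone {m} S) ≡ nothing
label-allDone leaf       = refl
label-allDone (node l r) = refl

allDone-correct : ∀ {m} {P C : List (Fin m → Bool)} {k} S → stopped P C k ≡ true
  → Correct P C k (allDone S)
allDone-correct leaf       st = st
allDone-correct (node l r) st =
  st , label-allDone l , label-allDone r , allDone-correct l st , allDone-correct r st

fillCost-allDone : ∀ {m} p S → fillCost p (allDone {m} S) ≡ 0ℚ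
fillCost-allDone p leaf       = refl
fillCost-allDone p (node l r) = begin
  0ℚ + mix p (fillCost p (allDone l)) (fillCost p (allDone r))
    ≡⟨ cong₂ (λ a b → 0ℚ + mix p a b) (fillCost-allDone p l) (fillCost-allDone p r) ⟩
  0ℚ + mix p 0ℚ 0ℚ
    ≡⟨ trans (ℚ.+-identityˡ _) (mix-const p 0ℚ) ⟩
  0ℚ ∎
  where open ≡-Reasoning

module _ (p : ℚ) .{{_ : NonNegative p}} .{{_ : NonNegative (1ℚ - p)}} where

  mix-mono-≤ : ∀ {a a′ b b′} → a ≤ a′ → b ≤ b′ → mix p a b ≤ mix p a′ b′
  mix-mono-≤ a≤a′ b≤b′ =
    ℚ.+-mono-≤ (ℚ.*-monoˡ-≤-nonNeg p a≤a′) (ℚ.*-monoˡ-≤-nonNeg (1ℚ - p) b≤b′)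

  mix-nonNeg : ∀ {a b} → 0ℚ ≤ a → 0ℚ ≤ b → 0ℚ ≤ mix p a b
  mix-nonNeg {a} {b} 0≤a 0≤b = subst (_≤ mix p a b) (mix-const p 0ℚ) (mix-mono-≤ 0≤a 0≤b)

  mutual
    fillCost-≤-levels : ∀ {m S n} (F : Filling m S) → levels S ≤ℕ n → fillCost p F ≤ fromℕ n
    fillCost-≤-levels {n = n}     (fleaf nothing)     _       = 0≤fromℕ n
    fillCost-≤-levels {n = suc n} (fleaf (just _))    _       = p≤p+q 1ℚ (0≤fromℕ n)
    fillCost-≤-levels {n = suc n} (fnode nothing l r)  (s≤s h) =
      ℚ.+-mono-≤ 0≤1 (mix-fillCost-≤-levels l r h)
    fillCost-≤-levels {n = suc n} (fnode (just _) l r) (s≤s h) =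
      ℚ.+-monoʳ-≤ 1ℚ (mix-fillCost-≤-levels l r h)

    mix-fillCost-≤-levels : ∀ {m Sl Sr n} (l : Filling m Sl) (r : Filling m Sr)
      → levels Sl ⊔ levels Sr ≤ℕ n → mix p (fillCost p l) (fillCost p r) ≤ fromℕ n
    mix-fillCost-≤-levels {n = n} l r h = begin
      mix p (fillCost p l) (fillCost p r)
        ≤⟨ mix-mono-≤ (fillCost-≤-levels l (ℕ.≤-trans (ℕ.m≤m⊔n _ _) h))
                      (fillCost-≤-levels r (ℕ.≤-trans (ℕ.m≤n⊔m _ _) h)) ⟩
      mix p (fromℕ n) (fromℕ n)
        ≡⟨ mix-const p (fromℕ n) ⟩
      fromℕ n ∎
      where open ℚ.≤-Reasoning

  policyCost-nonNeg : ∀ {m} (P C : List (Fin m → Bool)) b k π → 0ℚ ≤ policyCost p P C b k π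
  policyCost-nonNeg P C b k π with stopped P C k
  ... | true = ℚ.≤-refl
  policyCost-nonNeg P C zero    k π | false = ℚ.≤-refl
  policyCost-nonNeg P C (suc b) k halt | false = ℚ.≤-refl
  policyCost-nonNeg P C (suc b) k (ask e l r) | false with k e
  ... | just true  = ℚ.+-mono-≤ 0≤1 (policyCost-nonNeg P C b k l)
  ... | just false = ℚ.+-mono-≤ 0≤1 (policyCost-nonNeg P C b k r)
  ... | nothing    = ℚ.+-mono-≤ 0≤1
    (mix-nonNeg (policyCost-nonNeg P C b _ l) (policyCost-nonNeg P C b _ r))

f[argmin]≤f[∈] : ∀ {A : Set} (f : A → ℚ) x xs {y} → y ∈ x ∷ xs → f (argmin f x xs) ≤ f y
f[argmin]≤f[∈] f x xs (here refl) = f[argmin]≤f[⊤] {f = f} x xs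
f[argmin]≤f[∈] f x xs (there y∈xs) = lookupᴬ (f[argmin]≤f[xs] {f = f} x xs) y∈xs

module OptimalFilling {m : ℕ} (p : ℚ) (P C : List (Fin m → Bool)) where

  unknown? : (k : Know m) → Decidable (λ e → k e ≡ nothing)
  unknown? k e = Maybe.≡-dec Bool._≟_ (k e) nothing

  unknownEdges : Know m → List (Fin m)
  unknownEdges k = filter (unknown? k) (allFin m)

  unknownEdges-sound : ∀ {k e} → e ∈ unknownEdges k → k e ≡ nothing
  unknownEdges-sound {k} = proj₂ ∘ ∈-filter⁻ (unknown? k) {xs = allFin m}

  unknownEdges-complete : ∀ {k e} → k e ≡ nothing → e ∈ unknownEdges k
  unknownEdges-complete {k} = ∈-filter⁺ (unknown? k) (∈-allFin _)

  mutual
    optimal : (S : Shape) → Know m → Filling m S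
    optimal S k = if stopped P C k then allDone S else query S k (unknownEdges k)

    -- The junk case [] never arises for an unstopped k (unknownEdges-nonempty).
    query : (S : Shape) → Know m → List (Fin m) → Filling m S
    query S          k []       = allDone S
    query leaf       k (e ∷ _)  = fleaf (just e)
    query (node l r) k (e ∷ es) = fnode (just e*) (optimal l (reveal k e* true))
                                                  (optimal r (reveal k e* false))
      where e* = argmin (queryCost l r k) e es

    queryCost : Shape → Shape → Know m → Fin m → ℚ
    queryCost l r k e =
      mix p (fillCost p (optimal l (reveal k e true))) (fillCost p (optimal r (reveal k e false)))

  optimal-unstopped : ∀ S {k} → stopped P C k ≡ false → optimal S k ≡ query S k (unknownEdges k)
  optimal-unstopped S {k} = cong (λ b → if b then allDone S else query S k (unknownEdges k))

  module _ (stops-when-revealed : ∀ k → Revealed k → stopped P C k ≡ true) where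

    unknownEdges-nonempty : ∀ {k} → stopped P C k ≡ false → unknownEdges k ≢ []
    unknownEdges-nonempty {k} unstopped none = Bool.not-¬ (stops-when-revealed k revealed) unstopped
      where
      revealed : Revealed k
      revealed e = ∉[] ∘ subst (e ∈_) none ∘ unknownEdges-complete

    mutual
      optimal-correct : ∀ S k → Correct P C k (optimal S k)
      optimal-correct S k with stopped P C k in st
      ... | true  = allDone-correct S st
      ... | false = query-correct S k (unknownEdges k) (unknownEdges-nonempty st) unknownEdges-sound

      query-correct : ∀ S k es → es ≢ [] → (∀ {e} → e ∈ es → k e ≡ nothing)
        → Correct P C k (query S k es)
      query-correct S          k []       nonempty _       = ⊥-elim (nonempty refl)
      query-correct leaf       k (e ∷ es) _        unknown = unknown (here refl)
      query-correct (node l r) k (e ∷ es) _        unknown =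
        argmin-all (queryCost l r k) (unknown (here refl)) (tabulate (unknown ∘ there)) ,
        optimal-correct l _ , optimal-correct r _

  module _ .{{_ : NonNegative p}} .{{_ : NonNegative (1ℚ - p)}} where

    query-≤-ask : ∀ S k es {e d x y z} → e ∈ es → levels S ≤ℕ suc d
      → 0ℚ ≤ x → 0ℚ ≤ y → 0ℚ ≤ z
      → (∀ S′ → levels S′ ≤ℕ d → fillCost p (optimal S′ (reveal k e true))  ≤ x + z)
      → (∀ S′ → levels S′ ≤ℕ d → fillCost p (optimal S′ (reveal k e false)) ≤ y + z)
      → fillCost p (query S k es) ≤ (1ℚ + mix p x y) + z
    query-≤-ask S k [] () _
    query-≤-ask leaf k (_ ∷ _) _ _ 0≤x 0≤y 0≤z _ _ =
      ℚ.≤-trans (p≤p+q 1ℚ (mix-nonNeg p 0≤x 0≤y)) (p≤p+q _ 0≤z)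
    query-≤-ask (node l r) k (e₀ ∷ es) {e} {x = x} {y} {z} e∈es (s≤s h) _ _ _ on off = begin
      1ℚ + queryCost l r k (argmin (queryCost l r k) e₀ es)
        ≤⟨ ℚ.+-monoʳ-≤ 1ℚ (f[argmin]≤f[∈] (queryCost l r k) e₀ es e∈es) ⟩
      1ℚ + queryCost l r k e
        ≤⟨ ℚ.+-monoʳ-≤ 1ℚ (mix-mono-≤ p (on l (ℕ.≤-trans (ℕ.m≤m⊔n _ _) h))
                                      (off r (ℕ.≤-trans (ℕ.m≤n⊔m _ _) h))) ⟩
      1ℚ + mix p (x + z) (y + z)
        ≡⟨ cong (1ℚ +_) (mix-+ p x y z) ⟩
      1ℚ + (mix p x y + z)
        ≡⟨ sym (ℚ.+-assoc 1ℚ (mix p x y) z) ⟩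
      (1ℚ + mix p x y) + z ∎
      where open ℚ.≤-Reasoning

    wasted-query : ∀ S {k} c n → stopped P C k ≡ false
      → fillCost p (optimal S k) ≤ c + fromℕ (suc n)
      → fillCost p (query S k (unknownEdges k)) ≤ (1ℚ + c) + fromℕ n
    wasted-query S c n unstopped =
      subst₂ _≤_ (cong (fillCost p) (optimal-unstopped S unstopped)) (shift c (fromℕ n))
      where
      shift : ∀ a b → a + (1ℚ + b) ≡ (1ℚ + a) + b
      shift = solve 2 (λ a b → a :+ (con 1ℚ :+ b) := (con 1ℚ :+ a) :+ b) refl

    -- The slack fromℕ n pays for the queries of already revealed edges, which spend budget
    -- without descending in S.
    optimal-≤-policy : ∀ S b k π n → ValidPolicy P C b k π → levels S ≤ℕ b +ℕ n
      → fillCost p (optimal S k) ≤ policyCost p P C b k π + fromℕ n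
    optimal-≤-policy S b k π n valid h with stopped P C k in st
    ... | true = begin
      fillCost p (allDone S) ≡⟨ fillCost-allDone p S ⟩
      0ℚ                     ≤⟨ p≤p+q 0ℚ (0≤fromℕ n) ⟩
      0ℚ + fromℕ n           ∎
      where open ℚ.≤-Reasoning
    optimal-≤-policy S zero k π n valid h | false =
      subst (_ ≤_) (sym (ℚ.+-identityˡ _)) (fillCost-≤-levels p (query S k (unknownEdges k)) h)
    optimal-≤-policy S (suc b) k halt n () h | false
    optimal-≤-policy S (suc b) k (ask e l r) n valid h | false with k e in ke
    ... | just true  = wasted-query S (policyCost p P C b k l) n st
      (optimal-≤-policy S b k l (suc n) valid (subst (levels S ≤ℕ_) (sym (ℕ.+-suc b n)) h))
    ... | just false = wasted-query S (policyCost p P C b k r) n st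
      (optimal-≤-policy S b k r (suc n) valid (subst (levels S ≤ℕ_) (sym (ℕ.+-suc b n)) h))
    ... | nothing    = query-≤-ask S k (unknownEdges k) (unknownEdges-complete ke) h
      (policyCost-nonNeg p P C b _ l) (policyCost-nonNeg p P C b _ r) (0≤fromℕ n)
      (λ S′ h′ → optimal-≤-policy S′ b _ l n (proj₁ valid) h′)
      (λ S′ h′ → optimal-≤-policy S′ b _ r n (proj₂ valid) h′)

proposition2 : (G : Graph) (s t : Fin (nV G)) (p : ℚ) → 0ℚ < p → p < 1ℚ → (B : ℕ)
    → (P C : List (EdgeSet G)) → All (IsPath G s t) P → All (IsCut G s t) C
    → (S : Shape) → levels S ≤ℕ B
    → Σ (Filling (nE G) S) λ F → Correct P C unknown F
        × ((π : Policy (nE G)) → ValidPolicy P C B unknown π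
           → fillCost p F ≤ policyCost p P C B unknown π)
proposition2 G s t p 0<p p<1 B P C paths cuts S levels≤B =
  optimal S unknown ,
  optimal-correct (revealed⇒stopped paths cuts) S unknown ,
  λ π valid → subst (_ ≤_) (ℚ.+-identityʳ _)
    (optimal-≤-policy S B unknown π 0 valid (subst (levels S ≤ℕ_) (sym (ℕ.+-identityʳ B)) levels≤B))
  where
  open OptimalFilling p P C
  instance
    p-nonNeg : NonNegative p
    p-nonNeg = nonNegative (ℚ.<⇒≤ 0<p)
    1-p-nonNeg : NonNegative (1ℚ - p)
    1-p-nonNeg = nonNegative (subst (_≤ 1ℚ - p) (ℚ.+-inverseʳ p) (ℚ.+-monoˡ-≤ (- p) (ℚ.<⇒≤ p<1)))
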